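{- For every nonzero integer $m$ and every integer $n \ge 1$, \[ H_{n} \;=\; \frac{1}{m}\,\sum_{k=1}^{n} \frac{(-1)^{k+1}}{k}\,\binom{mk}{k}\binom{n + (m-1)k}{n - k}, \] where $H_n = \sum_{i=1}^{n} \frac{1}{i}$ is the $n$-th harmonic number.
   Context: Binomial coefficients are the generalized ones: for $a \in \mathbb{Z}$ and $b \in \mathbb{Z}_{\ge 0}$, $\binom{a}{b} = a(a-1)\cdots(a-b+1)/b!$ (so $\binom{a}{0}=1$, and $a$ may be negative). -}

module Defs where

open import Data.Nat as ℕ using (ℕ; zero; suc)
open import Data.Nat.Base using (_!)
open import Data.Nat.Properties using (_!≢0)
open import Data.Integer as ℤ using (ℤ; +_)
open import Data.Rational as ℚ using (ℚ; _/_)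

falling : ℤ → ℕ → ℤ
falling a zero    = + 1
falling a (suc b) = falling a b ℤ.* (a ℤ.- + b)

binom : ℤ → ℕ → ℚ
binom a b = (falling a b / (b !)) {{b !≢0}}

sum1 : ℕ → (ℕ → ℚ) → ℚ
sum1 zero    f = ℚ.0ℚ
sum1 (suc n) f = sum1 n f ℚ.+ f (suc n)

harmonic : ℕ → ℚ
harmonic n = sum1 n (λ i → + 1 / suc (ℕ.pred i))

sign : ℕ → ℚ
sign zero    = ℚ.1ℚ
sign (suc j) = ℚ.- sign j

recip : (m : ℤ) → .{{_ : ℤ.NonZero m}} → ℚ
recip m@(+ suc _)    = + 1 / ℤ.∣ m ∣
recip m@(ℤ.-[1+ _ ]) = ℤ.- (+ 1) / ℤ.∣ m ∣

{-# OPTIONS --safe #-}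
module Submission where

-- Writing S n for m times the right-hand side, it suffices that S (n + 1) - S n = m / (n + 1).
-- Pascal's rule in the upper index of the second binomial turns S (n + 1) - S n into
--   Σ_{k=1}^{n+1} (-1)^(k+1) C(mk,k)/k · C(n+(m-1)k, n+1-k),
-- and absorption with trinomial revision rewrite each summand as
--   m/(n+1) · (-1)^(k+1) C(n+1,k) · C(n+(m-1)k, n).
-- This is an alternating binomial sum of the polynomial k ↦ C(n+(m-1)k, n) of degree n: its
-- (n+1)-st finite difference vanishes, so the sum equals the value at k = 0, which is 1.

open import Data.Nat.Base as ℕ using (ℕ; zero; suc; _∸_; _!; _<_)
import Data.Nat.Properties as ℕ
open import Data.Nat.Properties using (_!≢0)
open import Data.Integer.Base as ℤ using (ℤ; +_; -[1+_])
import Data.Integer.Properties as ℤ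
open import Data.Integer.Tactic.RingSolver using (solve-∀)
open import Data.Rational.Base as ℚ using (ℚ; _/_; 0ℚ; 1ℚ; _+_; _*_; _-_; -_)
import Data.Rational.Properties as ℚ
import Data.Rational.Solver as ℚ-Solver
open import Data.Rational.Unnormalised.Base as ℚᵘ using (mkℚᵘ; *≡*)
import Data.Rational.Unnormalised.Properties as ℚᵘ
open import Algebra.Properties.Ring ℚ.+-*-ring using (-‿involutive; x[y-z]≈xy-xz)
open import Relation.Binary.PropositionalEquality
open ≡-Reasoning

open import Defs

open ℚ-Solver.+-*-Solver using (solve; _:=_; _:+_; _:-_; _:*_; :-_; con)

ι : ℤ → ℚ
ι a = a / 1

fromℚᵘ-homo-+ : ∀ p q → ℚ.fromℚᵘ (p ℚᵘ.+ q) ≡ ℚ.fromℚᵘ p + ℚ.fromℚᵘ q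
fromℚᵘ-homo-+ p q = ℚ.toℚᵘ-injective (ℚᵘ.≃-trans (ℚ.toℚᵘ-fromℚᵘ (p ℚᵘ.+ q))
  (ℚᵘ.≃-trans (ℚᵘ.+-cong (ℚᵘ.≃-sym (ℚ.toℚᵘ-fromℚᵘ p)) (ℚᵘ.≃-sym (ℚ.toℚᵘ-fromℚᵘ q)))
              (ℚᵘ.≃-sym (ℚ.toℚᵘ-homo-+ (ℚ.fromℚᵘ p) (ℚ.fromℚᵘ q)))))

fromℚᵘ-homo-* : ∀ p q → ℚ.fromℚᵘ (p ℚᵘ.* q) ≡ ℚ.fromℚᵘ p * ℚ.fromℚᵘ q
fromℚᵘ-homo-* p q = ℚ.toℚᵘ-injective (ℚᵘ.≃-trans (ℚ.toℚᵘ-fromℚᵘ (p ℚᵘ.* q))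
  (ℚᵘ.≃-trans (ℚᵘ.*-cong (ℚᵘ.≃-sym (ℚ.toℚᵘ-fromℚᵘ p)) (ℚᵘ.≃-sym (ℚ.toℚᵘ-fromℚᵘ q)))
              (ℚᵘ.≃-sym (ℚ.toℚᵘ-homo-* (ℚ.fromℚᵘ p) (ℚ.fromℚᵘ q)))))

ι-+ : ∀ a b → ι (a ℤ.+ b) ≡ ι a + ι b
ι-+ a b = trans
  (ℚ.fromℚᵘ-cong {mkℚᵘ (a ℤ.+ b) 0} {mkℚᵘ a 0 ℚᵘ.+ mkℚᵘ b 0} (*≡* (ring a b)))
  (fromℚᵘ-homo-+ (mkℚᵘ a 0) (mkℚᵘ b 0))
  where
  ring : ∀ a b → (a ℤ.+ b) ℤ.* + 1 ≡ (a ℤ.* + 1 ℤ.+ b ℤ.* + 1) ℤ.* + 1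
  ring = solve-∀

ι-* : ∀ a b → ι (a ℤ.* b) ≡ ι a * ι b
ι-* a b = fromℚᵘ-homo-* (mkℚᵘ a 0) (mkℚᵘ b 0)

ι-neg : ∀ a → ι (ℤ.- a) ≡ - ι a
ι-neg (+ zero)  = refl
ι-neg (+ suc n) = refl
ι-neg -[1+ n ]  = sym (-‿involutive (ι (+ suc n)))

ι-- : ∀ a b → ι (a ℤ.- b) ≡ ι a - ι b
ι-- a b = trans (ι-+ a (ℤ.- b)) (cong (ι a ℚ.+_) (ι-neg b))

a/n*n≡a : ∀ a n .{{_ : ℕ.NonZero n}} → a / n * ι (+ n) ≡ ι a
a/n*n≡a a (suc n) = trans (sym (fromℚᵘ-homo-* (mkℚᵘ a n) (mkℚᵘ (+ suc n) 0)))
  (ℚ.fromℚᵘ-cong {mkℚᵘ a n ℚᵘ.* mkℚᵘ (+ suc n) 0} {mkℚᵘ a 0} (*≡* (ring a (+ suc n))))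
  where
  ring : ∀ a d → (a ℤ.* d) ℤ.* + 1 ≡ a ℤ.* (d ℤ.* + 1)
  ring = solve-∀

a/n≡1/n*a : ∀ a n .{{_ : ℕ.NonZero n}} → a / n ≡ + 1 / n * ι a
a/n≡1/n*a a (suc n) = trans
  (ℚ.fromℚᵘ-cong {mkℚᵘ a n} {mkℚᵘ (+ 1) n ℚᵘ.* mkℚᵘ a 0} (*≡* (ring a (+ suc n))))
  (fromℚᵘ-homo-* (mkℚᵘ (+ 1) n) (mkℚᵘ a 0))
  where
  ring : ∀ a d → a ℤ.* (d ℤ.* + 1) ≡ (+ 1 ℤ.* a) ℤ.* d
  ring = solve-∀

*-cancelʳ-ι : ∀ n .{{_ : ℕ.NonZero n}} {p q} → p * ι (+ n) ≡ q * ι (+ n) → p ≡ q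
*-cancelʳ-ι n {p} {q} eq = trans (sym (undo p)) (trans (cong (_* (+ 1 / n)) eq) (undo q))
  where
  undo : ∀ r → r * ι (+ n) * (+ 1 / n) ≡ r
  undo r = begin
    r * ι (+ n) * (+ 1 / n)   ≡⟨ ℚ.*-assoc r _ _ ⟩
    r * (ι (+ n) * (+ 1 / n)) ≡⟨ cong (r *_) (trans (ℚ.*-comm (ι (+ n)) _) (a/n*n≡a (+ 1) n)) ⟩
    r * 1ℚ                    ≡⟨ ℚ.*-identityʳ r ⟩
    r                         ∎

/-cross : ∀ a b .{{_ : ℕ.NonZero a}} .{{_ : ℕ.NonZero b}} {p q} →
          ι (+ a) * p ≡ ι (+ b) * q → + 1 / b * p ≡ + 1 / a * q
/-cross a b {p} {q} eq = *-cancelʳ-ι a (*-cancelʳ-ι b (begin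
  + 1 / b * p * A * B
    ≡⟨ solve 4 (λ b p A B → b :* p :* A :* B := A :* p :* (b :* B)) refl (+ 1 / b) p A B ⟩
  A * p * (+ 1 / b * B)      ≡⟨ cong (A * p *_) (a/n*n≡a (+ 1) b) ⟩
  A * p * 1ℚ                 ≡⟨ cong (_* 1ℚ) eq ⟩
  B * q * 1ℚ                 ≡⟨ cong (B * q *_) (a/n*n≡a (+ 1) a) ⟨
  B * q * (+ 1 / a * A)
    ≡⟨ solve 4 (λ a q A B → B :* q :* (a :* A) := a :* q :* A :* B) refl (+ 1 / a) q A B ⟩
  + 1 / a * q * A * B        ∎))
  where
  A = ι (+ a)
  B = ι (+ b)

recip*ι≡1 : ∀ m .{{_ : ℤ.NonZero m}} → recip m * ι m ≡ 1ℚ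
recip*ι≡1 (+ suc n)  = a/n*n≡a (+ 1) (suc n)
recip*ι≡1 -[1+ n ]   = begin
  - x * - y     ≡⟨ ℚ.neg-distribˡ-* x (- y) ⟨
  - (x * - y)   ≡⟨ cong -_ (ℚ.neg-distribʳ-* x y) ⟨
  - - (x * y)   ≡⟨ -‿involutive (x * y) ⟩
  x * y         ≡⟨ a/n*n≡a (+ 1) (suc n) ⟩
  1ℚ            ∎
  where
  x = + 1 / suc n
  y = ι (+ suc n)

sum1-cong : ∀ n {f g : ℕ → ℚ} → (∀ k → k < n → f (suc k) ≡ g (suc k)) → sum1 n f ≡ sum1 n g
sum1-cong zero    eq = refl
sum1-cong (suc n) eq = cong₂ _+_ (sum1-cong n (λ k k<n → eq k (ℕ.m<n⇒m<1+n k<n))) (eq n (ℕ.n<1+n n))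

sum1-+ : ∀ n (f g : ℕ → ℚ) → sum1 n (λ k → f k + g k) ≡ sum1 n f + sum1 n g
sum1-+ zero    f g = refl
sum1-+ (suc n) f g = trans (cong (_+ (f (suc n) + g (suc n))) (sum1-+ n f g))
  (solve 4 (λ F G x y → (F :+ G) :+ (x :+ y) := (F :+ x) :+ (G :+ y)) refl
    (sum1 n f) (sum1 n g) (f (suc n)) (g (suc n)))

sum1-neg : ∀ n (f : ℕ → ℚ) → sum1 n (λ k → - f k) ≡ - sum1 n f
sum1-neg zero    f = refl
sum1-neg (suc n) f = trans (cong (_+ - f (suc n)) (sum1-neg n f))
  (sym (ℚ.neg-distrib-+ (sum1 n f) (f (suc n))))

sum1-* : ∀ n c (f : ℕ → ℚ) → sum1 n (λ k → c * f k) ≡ c * sum1 n f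
sum1-* zero    c f = sym (ℚ.*-zeroʳ c)
sum1-* (suc n) c f = trans (cong (_+ c * f (suc n)) (sum1-* n c f))
  (sym (ℚ.*-distribˡ-+ c (sum1 n f) (f (suc n))))

sum1-- : ∀ n (f g : ℕ → ℚ) → sum1 n (λ k → f k - g k) ≡ sum1 n f - sum1 n g
sum1-- n f g = trans (sum1-+ n f (λ k → - g k)) (cong (sum1 n f ℚ.+_) (sum1-neg n g))

sum1-head : ∀ n (f : ℕ → ℚ) → sum1 (suc n) f ≡ f 1 + sum1 n (λ k → f (suc k))
sum1-head zero    f = trans (ℚ.+-identityˡ (f 1)) (sym (ℚ.+-identityʳ (f 1)))
sum1-head (suc n) f = trans (cong (_+ f (suc (suc n))) (sum1-head n f))
  (ℚ.+-assoc (f 1) (sum1 n (λ k → f (suc k))) (f (suc (suc n))))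

falling-suc : ∀ a k → falling (+ 1 ℤ.+ a) (suc k) ≡ (+ 1 ℤ.+ a) ℤ.* falling a k
falling-suc a zero    = ring a
  where
  ring : ∀ a → + 1 ℤ.* (+ 1 ℤ.+ a ℤ.- + 0) ≡ (+ 1 ℤ.+ a) ℤ.* + 1
  ring = solve-∀
falling-suc a (suc k) =
  trans (cong (ℤ._* (+ 1 ℤ.+ a ℤ.- + suc k)) (falling-suc a k)) (ring a (falling a k) (+ k))
  where
  ring : ∀ a F k → (+ 1 ℤ.+ a) ℤ.* F ℤ.* (+ 1 ℤ.+ a ℤ.- (+ 1 ℤ.+ k))
                 ≡ (+ 1 ℤ.+ a) ℤ.* (F ℤ.* (a ℤ.- k))
  ring = solve-∀

falling-pascal : ∀ a k → falling (+ 1 ℤ.+ a) (suc k) ≡ falling a (suc k) ℤ.+ + suc k ℤ.* falling a k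
falling-pascal a k = trans (falling-suc a k) (ring a (falling a k) (+ k))
  where
  ring : ∀ a F k → (+ 1 ℤ.+ a) ℤ.* F ≡ F ℤ.* (a ℤ.- k) ℤ.+ (+ 1 ℤ.+ k) ℤ.* F
  ring = solve-∀

falling-+ : ∀ x i j → falling x (j ℕ.+ i) ≡ falling x i ℤ.* falling (x ℤ.- + i) j
falling-+ x i zero    = sym (ℤ.*-identityʳ (falling x i))
falling-+ x i (suc j) = begin
  falling x (j ℕ.+ i) ℤ.* (x ℤ.- + (j ℕ.+ i))
    ≡⟨ cong₂ ℤ._*_ (falling-+ x i j) (cong (λ y → x ℤ.- y) (ℤ.pos-+ j i)) ⟩
  falling x i ℤ.* falling (x ℤ.- + i) j ℤ.* (x ℤ.- (+ j ℤ.+ + i))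
    ≡⟨ ring x (+ i) (+ j) (falling x i) (falling (x ℤ.- + i) j) ⟩
  falling x i ℤ.* falling (x ℤ.- + i) (suc j) ∎
  where
  ring : ∀ x i j F G → F ℤ.* G ℤ.* (x ℤ.- (j ℤ.+ i)) ≡ F ℤ.* (G ℤ.* (x ℤ.- i ℤ.- j))
  ring = solve-∀

falling[n,n]≡n! : ∀ n → falling (+ n) n ≡ + (n !)
falling[n,n]≡n! zero    = refl
falling[n,n]≡n! (suc n) = begin
  falling (+ 1 ℤ.+ + n) (suc n)    ≡⟨ falling-suc (+ n) n ⟩
  + suc n ℤ.* falling (+ n) n      ≡⟨ cong (+ suc n ℤ.*_) (falling[n,n]≡n! n) ⟩
  + suc n ℤ.* + (n !)              ≡⟨ ℤ.pos-* (suc n) (n !) ⟨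
  + (suc n !)                      ∎

falling-*-! : ∀ i j → falling (+ (j ℕ.+ i)) j ℤ.* + (i !) ≡ + ((j ℕ.+ i) !)
falling-*-! i zero    = ℤ.*-identityˡ (+ (i !))
falling-*-! i (suc j) = begin
  falling (+ 1 ℤ.+ + n) (suc j) ℤ.* + (i !)  ≡⟨ cong (ℤ._* + (i !)) (falling-suc (+ n) j) ⟩
  + suc n ℤ.* falling (+ n) j ℤ.* + (i !)    ≡⟨ ℤ.*-assoc (+ suc n) (falling (+ n) j) (+ (i !)) ⟩
  + suc n ℤ.* (falling (+ n) j ℤ.* + (i !))  ≡⟨ cong (+ suc n ℤ.*_) (falling-*-! i j) ⟩
  + suc n ℤ.* + (n !)                        ≡⟨ ℤ.pos-* (suc n) (n !) ⟨
  + (suc n !)                                ∎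
  where n = j ℕ.+ i

binom*!≡falling : ∀ a k → binom a k * ι (+ (k !)) ≡ ι (falling a k)
binom*!≡falling a k = a/n*n≡a (falling a k) (k !) {{k !≢0}}

ι-suc! : ∀ k → ι (+ (suc k !)) ≡ ι (+ suc k) * ι (+ (k !))
ι-suc! k = trans (cong ι (ℤ.pos-* (suc k) (k !))) (ι-* (+ suc k) (+ (k !)))

binom-pascal : ∀ a k → binom (+ 1 ℤ.+ a) (suc k) ≡ binom a (suc k) + binom a k
binom-pascal a k = *-cancelʳ-ι (suc k !) {{suc k !≢0}} (begin
  binom (+ 1 ℤ.+ a) (suc k) * ι (+ (suc k !))
    ≡⟨ binom*!≡falling (+ 1 ℤ.+ a) (suc k) ⟩
  ι (falling (+ 1 ℤ.+ a) (suc k))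
    ≡⟨ cong ι (falling-pascal a k) ⟩
  ι (falling a (suc k) ℤ.+ + suc k ℤ.* falling a k)
    ≡⟨ trans (ι-+ (falling a (suc k)) (+ suc k ℤ.* falling a k))
             (cong (ι (falling a (suc k)) ℚ.+_) (ι-* (+ suc k) (falling a k))) ⟩
  ι (falling a (suc k)) + c * ι (falling a k)
    ≡⟨ cong₂ (λ u v → u + c * v) (binom*!≡falling a (suc k)) (binom*!≡falling a k) ⟨
  x * ι (+ (suc k !)) + c * (y * f)
    ≡⟨ cong (λ F → x * F + c * (y * f)) (ι-suc! k) ⟩
  x * (c * f) + c * (y * f)
    ≡⟨ solve 4 (λ x y c f → x :* (c :* f) :+ c :* (y :* f) := (x :+ y) :* (c :* f)) refl x y c f ⟩
  (x + y) * (c * f)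
    ≡⟨ cong ((x + y) *_) (ι-suc! k) ⟨
  (x + y) * ι (+ (suc k !)) ∎)
  where
  x = binom a (suc k)
  y = binom a k
  c = ι (+ suc k)
  f = ι (+ (k !))

binom-absorption : ∀ a k → ι (+ suc k) * binom (+ 1 ℤ.+ a) (suc k) ≡ ι (+ 1 ℤ.+ a) * binom a k
binom-absorption a k = *-cancelʳ-ι (k !) {{k !≢0}} (begin
  c * x * f                             ≡⟨ solve 3 (λ c x f → c :* x :* f := x :* (c :* f)) refl c x f ⟩
  x * (c * f)                           ≡⟨ cong (x *_) (ι-suc! k) ⟨
  x * ι (+ (suc k !))                   ≡⟨ binom*!≡falling (+ 1 ℤ.+ a) (suc k) ⟩
  ι (falling (+ 1 ℤ.+ a) (suc k))       ≡⟨ cong ι (falling-suc a k) ⟩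
  ι ((+ 1 ℤ.+ a) ℤ.* falling a k)       ≡⟨ ι-* (+ 1 ℤ.+ a) (falling a k) ⟩
  ι (+ 1 ℤ.+ a) * ι (falling a k)       ≡⟨ cong (ι (+ 1 ℤ.+ a) *_) (binom*!≡falling a k) ⟨
  ι (+ 1 ℤ.+ a) * (binom a k * f)       ≡⟨ ℚ.*-assoc (ι (+ 1 ℤ.+ a)) (binom a k) f ⟨
  ι (+ 1 ℤ.+ a) * binom a k * f         ∎)
  where
  c = ι (+ suc k)
  x = binom (+ 1 ℤ.+ a) (suc k)
  f = ι (+ (k !))

binom-absorption-multiple : ∀ m j →
  binom (m ℤ.* + suc j) (suc j) ≡ ι m * binom (m ℤ.* + suc j ℤ.- + 1) j
binom-absorption-multiple m j = *-cancelʳ-ι (suc j) (begin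
  binom (m ℤ.* k) (suc j) * ι k             ≡⟨ ℚ.*-comm (binom (m ℤ.* k) (suc j)) (ι k) ⟩
  ι k * binom (m ℤ.* k) (suc j)             ≡⟨ cong (λ x → ι k * binom x (suc j)) (ring m k) ⟩
  ι k * binom (+ 1 ℤ.+ a) (suc j)           ≡⟨ binom-absorption a j ⟩
  ι (+ 1 ℤ.+ a) * binom a j                 ≡⟨ cong (λ x → ι x * binom a j) (ring m k) ⟨
  ι (m ℤ.* k) * binom a j                   ≡⟨ cong (_* binom a j) (ι-* m k) ⟩
  ι m * ι k * binom a j
    ≡⟨ solve 3 (λ M K b → M :* K :* b := M :* b :* K) refl (ι m) (ι k) (binom a j) ⟩
  ι m * binom a j * ι k                     ∎)
  where
  k = + suc j
  a = m ℤ.* k ℤ.- + 1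
  ring : ∀ m k → m ℤ.* k ≡ + 1 ℤ.+ (m ℤ.* k ℤ.- + 1)
  ring = solve-∀

binom-revision : ∀ x i j →
  binom x i * binom (x ℤ.- + i) j ≡ binom (+ (j ℕ.+ i)) j * binom x (j ℕ.+ i)
binom-revision x i j = *-cancelʳ-ι (i !) {{i !≢0}} (*-cancelʳ-ι (j !) {{j !≢0}} (begin
  binom x i * binom (x ℤ.- + i) j * ι (+ (i !)) * ι (+ (j !))
    ≡⟨ solve 4 (λ b c I J → b :* c :* I :* J := (b :* I) :* (c :* J)) refl
         (binom x i) (binom (x ℤ.- + i) j) (ι (+ (i !))) (ι (+ (j !))) ⟩
  binom x i * ι (+ (i !)) * (binom (x ℤ.- + i) j * ι (+ (j !)))
    ≡⟨ cong₂ _*_ (binom*!≡falling x i) (binom*!≡falling (x ℤ.- + i) j) ⟩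
  ι (falling x i) * ι (falling (x ℤ.- + i) j)
    ≡⟨ trans (sym (ι-* (falling x i) _)) (cong ι (sym (falling-+ x i j))) ⟩
  ι (falling x n)
    ≡⟨ binom*!≡falling x n ⟨
  binom x n * ι (+ (n !))
    ≡⟨ cong (λ F → binom x n * ι F) (falling-*-! i j) ⟨
  binom x n * ι (falling (+ n) j ℤ.* + (i !))
    ≡⟨ cong (binom x n *_) (trans (ι-* (falling (+ n) j) (+ (i !)))
                                  (cong (_* ι (+ (i !))) (sym (binom*!≡falling (+ n) j)))) ⟩
  binom x n * (binom (+ n) j * ι (+ (j !)) * ι (+ (i !)))
    ≡⟨ solve 4 (λ b c I J → b :* (c :* J :* I) := c :* b :* I :* J) refl
         (binom x n) (binom (+ n) j) (ι (+ (i !))) (ι (+ (j !))) ⟩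
  binom (+ n) j * binom x n * ι (+ (i !)) * ι (+ (j !)) ∎))
  where n = j ℕ.+ i

binom-revision-absorption : ∀ y j d →
  + 1 / suc j * (binom (y ℤ.+ + d) d * binom y j)
    ≡ + 1 / suc (j ℕ.+ d) * (binom (+ suc (j ℕ.+ d)) (suc j) * binom (y ℤ.+ + d) (j ℕ.+ d))
binom-revision-absorption y j d = begin
  w * (binom x d * binom y j)                ≡⟨ cong (λ y → w * (binom x d * binom y j)) (ring y (+ d)) ⟩
  w * (binom x d * binom (x ℤ.- + d) j)      ≡⟨ cong (w *_) (binom-revision x d j) ⟩
  w * (binom (+ n) j * binom x n)            ≡⟨ ℚ.*-assoc w (binom (+ n) j) (binom x n) ⟨
  w * binom (+ n) j * binom x n
    ≡⟨ cong (_* binom x n) (/-cross (suc j) (suc n) (binom-absorption (+ n) j)) ⟨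
  v * binom (+ suc n) (suc j) * binom x n    ≡⟨ ℚ.*-assoc v (binom (+ suc n) (suc j)) (binom x n) ⟩
  v * (binom (+ suc n) (suc j) * binom x n)  ∎
  where
  n = j ℕ.+ d
  x = y ℤ.+ + d
  w = + 1 / suc j
  v = + 1 / suc n
  ring : ∀ y d → y ≡ y ℤ.+ d ℤ.- d
  ring = solve-∀

binom[n,n]≡1 : ∀ n → binom (+ n) n ≡ 1ℚ
binom[n,n]≡1 n = *-cancelʳ-ι (n !) {{n !≢0}}
  (trans (binom*!≡falling (+ n) n)
         (trans (cong ι (falling[n,n]≡n! n)) (sym (ℚ.*-identityˡ (ι (+ (n !)))))))

binom[n,1+n]≡0 : ∀ n → binom (+ n) (suc n) ≡ 0ℚ
binom[n,1+n]≡0 n = *-cancelʳ-ι (suc n !) {{suc n !≢0}} (begin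
  binom (+ n) (suc n) * ι (+ (suc n !))        ≡⟨ binom*!≡falling (+ n) (suc n) ⟩
  ι (falling (+ n) n ℤ.* (+ n ℤ.- + n))        ≡⟨ cong (λ z → ι (falling (+ n) n ℤ.* z)) (ℤ.+-inverseʳ (+ n)) ⟩
  ι (falling (+ n) n ℤ.* + 0)                  ≡⟨ cong ι (ℤ.*-zeroʳ (falling (+ n) n)) ⟩
  0ℚ                                           ≡⟨ ℚ.*-zeroˡ (ι (+ (suc n !))) ⟨
  0ℚ * ι (+ (suc n !))                         ∎)

Δ : (ℕ → ℚ) → ℕ → ℚ
Δ f k = f (suc k) - f k

data DegreeBelow : ℕ → (ℕ → ℚ) → Set where
  vanishes : ∀ {f} → (∀ k → f k ≡ 0ℚ) → DegreeBelow 0 f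
  Δ-below  : ∀ {d f} → DegreeBelow d (Δ f) → DegreeBelow (suc d) f

DegreeBelow-cong : ∀ {d} {f g : ℕ → ℚ} → (∀ k → f k ≡ g k) → DegreeBelow d f → DegreeBelow d g
DegreeBelow-cong f≗g (vanishes f≗0) = vanishes (λ k → trans (sym (f≗g k)) (f≗0 k))
DegreeBelow-cong f≗g (Δ-below hf)   =
  Δ-below (DegreeBelow-cong (λ k → cong₂ _-_ (f≗g (suc k)) (f≗g k)) hf)

DegreeBelow-vanishing : ∀ d {f : ℕ → ℚ} → (∀ k → f k ≡ 0ℚ) → DegreeBelow d f
DegreeBelow-vanishing zero    f≗0 = vanishes f≗0
DegreeBelow-vanishing (suc d) f≗0 =
  Δ-below (DegreeBelow-vanishing d (λ k → cong₂ _-_ (f≗0 (suc k)) (f≗0 k)))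

DegreeBelow-shift : ∀ {d} {f : ℕ → ℚ} → DegreeBelow d f → DegreeBelow d (λ k → f (suc k))
DegreeBelow-shift (vanishes f≗0) = vanishes (λ k → f≗0 (suc k))
DegreeBelow-shift (Δ-below hf)   = Δ-below (DegreeBelow-shift hf)

DegreeBelow-+ : ∀ {d} {f g : ℕ → ℚ} → DegreeBelow d f → DegreeBelow d g →
                DegreeBelow d (λ k → f k + g k)
DegreeBelow-+ (vanishes f≗0) (vanishes g≗0) = vanishes (λ k → cong₂ _+_ (f≗0 k) (g≗0 k))
DegreeBelow-+ {f = f} {g} (Δ-below hf) (Δ-below hg) =
  Δ-below (DegreeBelow-cong Δ-+ (DegreeBelow-+ hf hg))
  where
  Δ-+ : ∀ k → Δ f k + Δ g k ≡ Δ (λ k → f k + g k) k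
  Δ-+ k = solve 4 (λ a b c d → (a :- b) :+ (c :- d) := (a :+ c) :- (b :+ d)) refl
    (f (suc k)) (f k) (g (suc k)) (g k)

DegreeBelow-* : ∀ a b {f g : ℕ → ℚ} → DegreeBelow (suc a) f → DegreeBelow (suc b) g →
                DegreeBelow (suc (a ℕ.+ b)) (λ k → f k * g k)
DegreeBelow-* a b {f} {g} hf@(Δ-below Δf-below) hg@(Δ-below Δg-below) =
  Δ-below (DegreeBelow-cong Δ-* (DegreeBelow-+ (Δg-term b Δg-below) (Δf-term a Δf-below)))
  where
  Δ-* : ∀ k → f (suc k) * Δ g k + Δ f k * g k ≡ Δ (λ k → f k * g k) k
  Δ-* k = solve 4 (λ F f G g → F :* (G :- g) :+ (F :- f) :* g := F :* G :- f :* g) refl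
    (f (suc k)) (f k) (g (suc k)) (g k)
  Δg-term : ∀ b → DegreeBelow b (Δ g) → DegreeBelow (a ℕ.+ b) (λ k → f (suc k) * Δ g k)
  Δg-term zero    (vanishes Δg≗0) = DegreeBelow-vanishing (a ℕ.+ 0)
    (λ k → trans (cong (f (suc k) *_) (Δg≗0 k)) (ℚ.*-zeroʳ (f (suc k))))
  Δg-term (suc b) Δg-below        = subst (λ d → DegreeBelow d (λ k → f (suc k) * Δ g k))
    (sym (ℕ.+-suc a b)) (DegreeBelow-* a b (DegreeBelow-shift hf) Δg-below)
  Δf-term : ∀ a → DegreeBelow a (Δ f) → DegreeBelow (a ℕ.+ b) (λ k → Δ f k * g k)
  Δf-term zero    (vanishes Δf≗0) = DegreeBelow-vanishing b
    (λ k → trans (cong (_* g k) (Δf≗0 k)) (ℚ.*-zeroˡ (g k)))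
  Δf-term (suc a) Δf-below        = DegreeBelow-* a b Δf-below hg

DegreeBelow-const : ∀ c → DegreeBelow 1 (λ _ → c)
DegreeBelow-const c = Δ-below (vanishes (λ _ → ℚ.+-inverseʳ c))

DegreeBelow-affine : ∀ c d → DegreeBelow 2 (λ k → ι (d ℤ.+ c ℤ.* + k))
DegreeBelow-affine c d = Δ-below (DegreeBelow-cong Δ-affine (DegreeBelow-const (ι c)))
  where
  ring : ∀ c d k → c ≡ d ℤ.+ c ℤ.* (+ 1 ℤ.+ k) ℤ.- (d ℤ.+ c ℤ.* k)
  ring = solve-∀
  Δ-affine : ∀ k → ι c ≡ Δ (λ k → ι (d ℤ.+ c ℤ.* + k)) k
  Δ-affine k = trans (cong ι (ring c d (+ k))) (ι-- (d ℤ.+ c ℤ.* + suc k) (d ℤ.+ c ℤ.* + k))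

DegreeBelow-falling : ∀ c d j → DegreeBelow (suc j) (λ k → ι (falling (d ℤ.+ c ℤ.* + k) j))
DegreeBelow-falling c d zero    = DegreeBelow-const (ι (+ 1))
DegreeBelow-falling c d (suc j) = DegreeBelow-cong factor
  (DegreeBelow-* 1 j (DegreeBelow-affine c (d ℤ.- + j)) (DegreeBelow-falling c d j))
  where
  ring : ∀ c d j k → d ℤ.- j ℤ.+ c ℤ.* k ≡ d ℤ.+ c ℤ.* k ℤ.- j
  ring = solve-∀
  factor : ∀ k → ι (d ℤ.- + j ℤ.+ c ℤ.* + k) * ι (falling (d ℤ.+ c ℤ.* + k) j)
               ≡ ι (falling (d ℤ.+ c ℤ.* + k) (suc j))
  factor k = begin
    ι (d ℤ.- + j ℤ.+ c ℤ.* + k) * ι F     ≡⟨ cong (λ y → ι y * ι F) (ring c d (+ j) (+ k)) ⟩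
    ι (y ℤ.- + j) * ι F                   ≡⟨ ℚ.*-comm (ι (y ℤ.- + j)) (ι F) ⟩
    ι F * ι (y ℤ.- + j)                   ≡⟨ ι-* F (y ℤ.- + j) ⟨
    ι (F ℤ.* (y ℤ.- + j))                 ∎
    where
    y = d ℤ.+ c ℤ.* + k
    F = falling y j

DegreeBelow-binom : ∀ c d j → DegreeBelow (suc j) (λ k → binom (d ℤ.+ c ℤ.* + k) j)
DegreeBelow-binom c d j = DegreeBelow-cong
  (λ k → sym (a/n≡1/n*a (falling (d ℤ.+ c ℤ.* + k) j) (j !) {{j !≢0}}))
  (DegreeBelow-* 0 j (DegreeBelow-const ((+ 1 / j !) {{j !≢0}})) (DegreeBelow-falling c d j))

alternating-sum : ℕ → (ℕ → ℚ) → ℚ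
alternating-sum n f = sum1 n (λ k → sign (suc k) * binom (+ n) k * f k)

alternating-sum-Δ : ∀ n f →
  alternating-sum n (Δ f) ≡ alternating-sum n (λ k → f (suc k)) - alternating-sum n f
alternating-sum-Δ n f = trans (sum1-cong n (λ k _ → x[y-z]≈xy-xz (c (suc k)) (f (suc (suc k))) (f (suc k))))
                              (sum1-- n (λ k → c k * f (suc k)) (λ k → c k * f k))
  where
  c : ℕ → ℚ
  c k = sign (suc k) * binom (+ n) k

alternating-sum-suc : ∀ n f → alternating-sum (suc n) f ≡ f 1 - alternating-sum n (Δ f)
alternating-sum-suc n f = begin
  alternating-sum (suc n) f
    ≡⟨ sum1-cong (suc n) (λ k _ → split k) ⟩
  sum1 (suc n) (λ k → u k + v k)
    ≡⟨ sum1-+ (suc n) u v ⟩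
  sum1 n u + u (suc n) + sum1 (suc n) v
    ≡⟨ cong₂ _+_ (cong (A ℚ.+_) last-vanishes) (sum1-head n v) ⟩
  A + 0ℚ + (v 1 + sum1 n (λ k → v (suc k)))
    ≡⟨ cong (λ z → A + 0ℚ + (v 1 + z)) (trans (sum1-cong n (λ k _ → shifted k)) (sum1-neg n _)) ⟩
  A + 0ℚ + (v 1 + - B)
    -- v 1 reduces to 1ℚ * 1ℚ * f 1
    ≡⟨ solve 3 (λ A B F → A :+ con 0ℚ :+ (con 1ℚ :* con 1ℚ :* F :+ :- B) := F :- (B :- A)) refl
         A B (f 1) ⟩
  f 1 - (B - A)
    ≡⟨ cong (λ z → f 1 - z) (alternating-sum-Δ n f) ⟨
  f 1 - alternating-sum n (Δ f) ∎
  where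
  u v : ℕ → ℚ
  u k = sign (suc k) * binom (+ n) k * f k
  v k = sign (suc k) * binom (+ n) (ℕ.pred k) * f k
  A = alternating-sum n f
  B = alternating-sum n (λ k → f (suc k))
  split : ∀ k → sign (suc (suc k)) * binom (+ suc n) (suc k) * f (suc k) ≡ u (suc k) + v (suc k)
  split k = trans (cong (λ b → sign (suc (suc k)) * b * f (suc k)) (binom-pascal (+ n) k))
    (solve 4 (λ s x y F → s :* (x :+ y) :* F := s :* x :* F :+ s :* y :* F) refl
      (sign (suc (suc k))) (binom (+ n) (suc k)) (binom (+ n) k) (f (suc k)))
  last-vanishes : u (suc n) ≡ 0ℚ
  last-vanishes = begin
    s * binom (+ n) (suc n) * f (suc n)   ≡⟨ cong (λ b → s * b * f (suc n)) (binom[n,1+n]≡0 n) ⟩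
    s * 0ℚ * f (suc n)                    ≡⟨ cong (_* f (suc n)) (ℚ.*-zeroʳ s) ⟩
    0ℚ * f (suc n)                        ≡⟨ ℚ.*-zeroˡ (f (suc n)) ⟩
    0ℚ                                    ∎
    where s = sign (suc (suc n))
  shifted : ∀ k → v (suc (suc k)) ≡ - (sign (suc (suc k)) * binom (+ n) (suc k) * f (suc (suc k)))
  shifted k = sym (trans (ℚ.neg-distribˡ-* (s * b) (f (suc (suc k))))
                         (cong (_* f (suc (suc k))) (ℚ.neg-distribˡ-* s b)))
    where
    s = sign (suc (suc k))
    b = binom (+ n) (suc k)

alternating-binomial-sum : ∀ n {f} → DegreeBelow n f → alternating-sum n f ≡ f 0
alternating-binomial-sum zero        (vanishes f≗0) = sym (f≗0 0)
alternating-binomial-sum (suc n) {f} (Δ-below hf)  = begin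
  alternating-sum (suc n) f            ≡⟨ alternating-sum-suc n f ⟩
  f 1 - alternating-sum n (Δ f)        ≡⟨ cong (λ z → f 1 - z) (alternating-binomial-sum n hf) ⟩
  f 1 - (f 1 - f 0)                    ≡⟨ solve 2 (λ a b → a :- (a :- b) := b) refl (f 1) (f 0) ⟩
  f 0                                  ∎

module _ (m : ℤ) where

  coefficient : ℕ → ℚ
  coefficient k = sign (suc k) * (+ 1 / suc (ℕ.pred k)) * binom (m ℤ.* + k) k

  upper : ℕ → ℕ → ℤ
  upper n k = + n ℤ.+ (m ℤ.- + 1) ℤ.* + k

  term : ℕ → ℕ → ℚ
  term n k = coefficient k * binom (upper n k) (n ∸ k)

  increment : ℕ → ℕ → ℚ
  increment n k = coefficient k * binom (upper n k) (suc n ∸ k)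

  term-suc : ∀ n j → j < n → term (suc n) (suc j) ≡ term n (suc j) + increment n (suc j)
  term-suc n j j<n = begin
    c * binom (upper (suc n) (suc j)) (n ∸ j)
      ≡⟨ cong (λ x → c * binom x (n ∸ j)) (ℤ.+-assoc (+ 1) (+ n) ((m ℤ.- + 1) ℤ.* + suc j)) ⟩
    c * binom (+ 1 ℤ.+ x) (n ∸ j)         ≡⟨ cong (λ i → c * binom (+ 1 ℤ.+ x) i) n∸j≡1+i ⟩
    c * binom (+ 1 ℤ.+ x) (suc i)         ≡⟨ cong (c *_) (binom-pascal x i) ⟩
    c * (binom x (suc i) + binom x i)     ≡⟨ ℚ.*-distribˡ-+ c (binom x (suc i)) (binom x i) ⟩
    c * binom x (suc i) + c * binom x i   ≡⟨ ℚ.+-comm (c * binom x (suc i)) (c * binom x i) ⟩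
    c * binom x i + c * binom x (suc i)   ≡⟨ cong (λ l → c * binom x i + c * binom x l) n∸j≡1+i ⟨
    term n (suc j) + increment n (suc j)  ∎
    where
    c = coefficient (suc j)
    x = upper n (suc j)
    i = n ∸ suc j
    n∸j≡1+i : n ∸ j ≡ suc i
    n∸j≡1+i = ℕ.+-∸-assoc 1 j<n

  -- Both sides are coefficient (suc n) * binom _ 0, and binom a 0 does not depend on a.
  term-last : ∀ n → term (suc n) (suc n) ≡ increment n (suc n)
  term-last n = cong (coefficient (suc n) *_) (trans
    (cong (binom (upper (suc n) (suc n))) (ℕ.n∸n≡0 n))
    (sym (cong (binom (upper n (suc n))) (ℕ.n∸n≡0 n))))

  increment≡alternating-summand : ∀ n j → j ℕ.≤ n →
    increment n (suc j)
      ≡ ι m * (+ 1 / suc n) * (sign (suc (suc j)) * binom (+ suc n) (suc j) * binom (upper n (suc j)) n)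
  increment≡alternating-summand n j j≤n = begin
    s * w * B * binom x d
      ≡⟨ cong (λ B → s * w * B * binom x d) (binom-absorption-multiple m j) ⟩
    s * w * (ι m * binom a j) * binom x d
      ≡⟨ solve 5 (λ s w M A X → s :* w :* (M :* A) :* X := s :* M :* (w :* (X :* A))) refl
           s w (ι m) (binom a j) (binom x d) ⟩
    s * ι m * (w * (binom x d * binom a j))
      ≡⟨ cong (λ x → s * ι m * (w * (binom x d * binom a j))) x≡a+d ⟩
    s * ι m * (w * (binom (a ℤ.+ + d) d * binom a j))
      ≡⟨ cong (s * ι m *_) (binom-revision-absorption a j d) ⟩
    s * ι m * (+ 1 / suc (j ℕ.+ d) * (binom (+ suc (j ℕ.+ d)) (suc j) * binom (a ℤ.+ + d) (j ℕ.+ d)))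
      ≡⟨ cong₂ (λ N y → s * ι m * (+ 1 / suc N * (binom (+ suc N) (suc j) * binom y N)))
               (ℕ.m+[n∸m]≡n j≤n) (sym x≡a+d) ⟩
    s * ι m * (v * (C * binom x n))
      ≡⟨ solve 5 (λ s M v C X → s :* M :* (v :* (C :* X)) := M :* v :* (s :* C :* X)) refl
           s (ι m) v C (binom x n) ⟩
    ι m * v * (s * C * binom x n) ∎
    where
    s = sign (suc (suc j))
    w = + 1 / suc j
    v = + 1 / suc n
    B = binom (m ℤ.* + suc j) (suc j)
    C = binom (+ suc n) (suc j)
    x = upper n (suc j)
    d = n ∸ j
    a = m ℤ.* + suc j ℤ.- + 1
    ring : ∀ m j d → j ℤ.+ d ℤ.+ (m ℤ.- + 1) ℤ.* (+ 1 ℤ.+ j)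
                   ≡ m ℤ.* (+ 1 ℤ.+ j) ℤ.- + 1 ℤ.+ d
    ring = solve-∀
    x≡a+d : x ≡ a ℤ.+ + d
    x≡a+d = trans (cong (λ N → N ℤ.+ (m ℤ.- + 1) ℤ.* + suc j)
                        (trans (cong +_ (sym (ℕ.m+[n∸m]≡n j≤n))) (ℤ.pos-+ j d)))
                  (ring m (+ j) (+ d))

  sum1-increment : ∀ n → sum1 (suc n) (increment n) ≡ ι m * (+ 1 / suc n)
  sum1-increment n = begin
    sum1 (suc n) (increment n)
      ≡⟨ sum1-cong (suc n) (λ j j<1+n → increment≡alternating-summand n j (ℕ.s≤s⁻¹ j<1+n)) ⟩
    sum1 (suc n) (λ k → M * (sign (suc k) * binom (+ suc n) k * binom (upper n k) n))
      ≡⟨ sum1-* (suc n) M _ ⟩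
    M * alternating-sum (suc n) (λ k → binom (upper n k) n)
      ≡⟨ cong (M *_) (alternating-binomial-sum (suc n) (DegreeBelow-binom (m ℤ.- + 1) (+ n) n)) ⟩
    M * binom (upper n 0) n
      ≡⟨ cong (λ x → M * binom x n) upper[n,0]≡n ⟩
    M * binom (+ n) n
      ≡⟨ trans (cong (M *_) (binom[n,n]≡1 n)) (ℚ.*-identityʳ M) ⟩
    M ∎
    where
    M = ι m * (+ 1 / suc n)
    upper[n,0]≡n : upper n 0 ≡ + n
    upper[n,0]≡n = trans (cong (ℤ._+_ (+ n)) (ℤ.*-zeroʳ (m ℤ.- + 1))) (ℤ.+-identityʳ (+ n))

  sum1-term : ∀ n → sum1 n (term n) ≡ ι m * harmonic n
  sum1-term zero    = sym (ℚ.*-zeroʳ (ι m))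
  sum1-term (suc n) = begin
    sum1 n (term (suc n)) + term (suc n) (suc n)
      ≡⟨ cong₂ _+_ (sum1-cong n (term-suc n)) (term-last n) ⟩
    sum1 n (λ k → term n k + increment n k) + increment n (suc n)
      ≡⟨ cong (_+ increment n (suc n)) (sum1-+ n (term n) (increment n)) ⟩
    sum1 n (term n) + sum1 n (increment n) + increment n (suc n)
      ≡⟨ ℚ.+-assoc (sum1 n (term n)) (sum1 n (increment n)) (increment n (suc n)) ⟩
    sum1 n (term n) + sum1 (suc n) (increment n)
      ≡⟨ cong₂ _+_ (sum1-term n) (sum1-increment n) ⟩
    ι m * harmonic n + ι m * (+ 1 / suc n)
      ≡⟨ ℚ.*-distribˡ-+ (ι m) (harmonic n) (+ 1 / suc n) ⟨
    ι m * harmonic (suc n) ∎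

theorem1p1 : (m : ℤ) → .{{_ : ℤ.NonZero m}} → (n : ℕ) → .{{_ : ℕ.NonZero n}} →
    harmonic n ≡ recip m ℚ.* sum1 n (λ k → sign (suc k) ℚ.* (+ 1 / suc (ℕ.pred k)) ℚ.* binom (m ℤ.* + k) k ℚ.* binom (+ n ℤ.+ (m ℤ.- + 1) ℤ.* + k) (n ∸ k))
-- The identity also holds for n = 0, where both sides vanish.
theorem1p1 m n = begin
  harmonic n                           ≡⟨ ℚ.*-identityˡ (harmonic n) ⟨
  1ℚ * harmonic n                      ≡⟨ cong (_* harmonic n) (recip*ι≡1 m) ⟨
  recip m * ι m * harmonic n           ≡⟨ ℚ.*-assoc (recip m) (ι m) (harmonic n) ⟩
  recip m * (ι m * harmonic n)         ≡⟨ cong (recip m *_) (sum1-term m n) ⟨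
  recip m * sum1 n (term m n)          ∎
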